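{- Let $a,b,d,e,f\in\mathbb{Z}$ with $\Delta_Q:=ae^2-deb+fb^2\ne0$. Then: (i) the function $\rho^*$ is supported on the positive divisors of $\Delta_Q/\gcd(b,e)$, i.e. $\rho^*(n)=0$ unless $n\mid \Delta_Q/\gcd(b,e)$; (ii) for every positive integer $n$, $\rho^*(n)\le n\gcd(b,e)$.
   Context: Put $L(s,t):=bs+et$ and $g(s,t):=as^2+dst+ft^2$, and let $\mathbf{q}(s,t):=(sL(s,t),\,-g(s,t),\,tL(s,t))$ (equivalently $\mathbf{q}(s,t)=\Pi(s^2,st,t^2)^T$ with $\Pi$ the matrix with rows $(b,e,0)$, $(-a,-d,-f)$, $(0,b,e)$). For a positive integer $n$, $\rho^*(n):=\#\{(s,t)\in[0,n)^2\cap\mathbb{Z}^2: n\mid \mathbf{q}(s,t),\ \gcd(s,t,n)=1\}$, where $n\mid\mathbf{q}(s,t)$ means $n$ divides each coordinate. (The hypothesis $\Delta_Q\neq 0$ corresponds to the form $ax^2+bxy+dxz+eyz+fz^2$ being non-singular.) -}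

module Defs where

open import Data.Nat as ℕ using (ℕ; zero; suc)
open import Data.Nat.GCD using (gcd)
import Data.Nat.Divisibility as ℕD
open import Data.Integer as ℤ using (ℤ; +_; ∣_∣)
open import Data.Integer.Divisibility as ℤD using ()
open import Data.Product using (_×_; _,_)
open import Data.List using (List; length; filter; upTo; concatMap; map)
open import Relation.Nullary using (Dec; yes; no)
open import Relation.Nullary.Decidable using (_×-dec_)
open import Relation.Binary.PropositionalEquality using (_≡_)

-- Coefficients (a , b , d , e , f) of the quadratic form
-- Q(x,y,z) = a x² + b x y + d x z + e y z + f z².
record Coeffs : Set where
  constructor coeffs
  field
    a b d e f : ℤ
open Coeffs public

ΔQ : Coeffs → ℤ
ΔQ c = a c ℤ.* e c ℤ.* e c ℤ.- d c ℤ.* e c ℤ.* b c ℤ.+ f c ℤ.* b c ℤ.* b c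

Lf : Coeffs → ℤ → ℤ → ℤ
Lf c s t = b c ℤ.* s ℤ.+ e c ℤ.* t

gf : Coeffs → ℤ → ℤ → ℤ
gf c s t = a c ℤ.* s ℤ.* s ℤ.+ d c ℤ.* s ℤ.* t ℤ.+ f c ℤ.* t ℤ.* t

q₁ q₂ q₃ : Coeffs → ℤ → ℤ → ℤ
q₁ c s t = s ℤ.* Lf c s t
q₂ c s t = ℤ.- gf c s t
q₃ c s t = t ℤ.* Lf c s t

Good : Coeffs → ℕ → ℕ → ℕ → Set
Good c n s t =
  ((+ n) ℤD.∣ q₁ c (+ s) (+ t)
    × (+ n) ℤD.∣ q₂ c (+ s) (+ t)
    × (+ n) ℤD.∣ q₃ c (+ s) (+ t))
  × gcd (gcd s t) n ≡ 1

good? : ∀ c n s t → Dec (Good c n s t)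
good? c n s t =
  ((n ℕD.∣? ∣ q₁ c (+ s) (+ t) ∣)
    ×-dec (n ℕD.∣? ∣ q₂ c (+ s) (+ t) ∣)
    ×-dec (n ℕD.∣? ∣ q₃ c (+ s) (+ t) ∣))
  ×-dec (gcd (gcd s t) n ℕ.≟ 1)

pairs : ℕ → List (ℕ × ℕ)
pairs n = concatMap (λ s → map (λ t → s , t) (upTo n)) (upTo n)

ρ* : Coeffs → ℕ → ℕ
ρ* c n = length (filter (λ p → good? c n (Data.Product.proj₁ p) (Data.Product.proj₂ p)) (pairs n))
  where import Data.Product

gcdBE : Coeffs → ℕ
gcdBE c = gcd ∣ b c ∣ ∣ e c ∣

-- Δ_Q / gcd(b,e) (exact integer division; gcd(b,e) ∣ Δ_Q).  The case gcd(b,e) = 0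
-- (i.e. b = e = 0) forces Δ_Q = 0 and is excluded by the hypothesis; we put 0 there.
ΔQ/gcd : Coeffs → ℤ
ΔQ/gcd c with gcdBE c
... | zero  = ℤ.0ℤ
... | suc k = ΔQ c DM./ (+ suc k)
  where import Data.Integer.DivMod as DM

{-# OPTIONS --safe #-}
module Submission where

-- Write G = gcd(b,e), b = Gβ, e = Gε, and let Q₀ be the form with coefficients (a,β,d,ε,f),
-- so that L = G·L₀ and Δ_Q = G²·Δ_{Q₀}.  If n ∣ q(s,t) and gcd(s,t,n) = 1, then n ∣ L (cancel
-- s and t from n ∣ sL, n ∣ tL) and n ∣ g.  The identities
--   s²Δ = e²g − L(des + fet − fbs),   t²Δ = b²g − L(abs − aet + dbt),   stΔ = L(aes + fbt) − beg
-- for Q₀, multiplied by G, show that n divides s², t² and st times GΔ_{Q₀}, hence n ∣ GΔ_{Q₀} = Δ_Q/G.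
-- For the bound pick u, v with uβ + vε = 1: the residues of L₀ and of vs − ut modulo n determine
-- (s,t) modulo n, and since n ∣ G·L₀ the residue r of L₀ is determined by ⌊Gr/n⌋ < G, so the good
-- pairs inject into [0,n) × [0,G).

module IntegerArithmetic where

  open import Data.Nat as ℕ using (suc)
  import Data.Nat.Properties as ℕ
  import Data.Nat.Divisibility as ℕ
  open import Data.Nat.DivMod using (m<n⇒m%n≡m)
  open import Data.Nat.GCD using (gcd; gcd-GCD; gcd-greatest; c*gcd[m,n]≡gcd[cm,cn]; module Bézout)
  open import Data.Nat.Coprimality using (gcd≡1⇒coprime; coprime-divisor)
  import Data.Nat.Coprimality as Coprime
  open import Data.Integer
  open import Data.Integer.Properties
  open import Data.Integer.Divisibility.Signed
  open import Data.Integer.DivMod using (_/_; _%_; a≡a%n+[a/n]*n; n%d<d)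
  open import Data.Integer.Tactic.RingSolver using (solve-∀)
  open import Data.Product using (_×_; _,_; ∃₂)
  open import Relation.Nullary using (yes; no)
  open import Relation.Binary.PropositionalEquality
  open ≡-Reasoning

  ∣-cancel-coprimeℕ : ∀ {n s t y} → gcd (gcd s t) n ≡ 1 →
                      n ℕ.∣ s ℕ.* y → n ℕ.∣ t ℕ.* y → n ℕ.∣ y
  ∣-cancel-coprimeℕ {n} {s} {t} {y} coprime n∣sy n∣ty =
    coprime-divisor (Coprime.sym (gcd≡1⇒coprime {m = gcd s t} coprime)) n∣gcd[s,t]*y
    where
    n∣gcd[s,t]*y : n ℕ.∣ gcd s t ℕ.* y
    n∣gcd[s,t]*y = subst (n ℕ.∣_)
      (trans (sym (c*gcd[m,n]≡gcd[cm,cn] y s t)) (ℕ.*-comm y (gcd s t)))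
      (gcd-greatest (subst (n ℕ.∣_) (ℕ.*-comm s y) n∣sy) (subst (n ℕ.∣_) (ℕ.*-comm t y) n∣ty))

  ∣-cancel-coprime : ∀ {n s t y} → gcd (gcd s t) n ≡ 1 →
                     + n ∣ + s * y → + n ∣ + t * y → + n ∣ y
  ∣-cancel-coprime {s = s} {t} {y} coprime n∣sy n∣ty = ∣ᵤ⇒∣ (∣-cancel-coprimeℕ {s = s} {t} coprime
    (subst (_ ℕ.∣_) (abs-* (+ s) y) (∣⇒∣ᵤ n∣sy))
    (subst (_ ℕ.∣_) (abs-* (+ t) y) (∣⇒∣ᵤ n∣ty)))

  ∣∧<⇒≡0 : ∀ {m n} → n ℕ.∣ m → m ℕ.< n → m ≡ 0
  ∣∧<⇒≡0 {n = suc _} n∣m m<n = trans (sym (m<n⇒m%n≡m m<n)) (ℕ.n∣m⇒m%n≡0 _ _ n∣m)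

  ∣⊖⇒≤ : ∀ {n s s′} → s ℕ.< n → n ℕ.∣ ∣ s ⊖ s′ ∣ → s ℕ.≤ s′
  ∣⊖⇒≤ {n} {s} {s′} s<n n∣s⊖s′ with s ℕ.≤? s′
  ... | yes s≤s′ = s≤s′
  ... | no s≰s′ = ℕ.m∸n≡0⇒m≤n (∣∧<⇒≡0 n∣s∸s′ (ℕ.≤-<-trans (ℕ.m∸n≤m s s′) s<n))
    where
    n∣s∸s′ : n ℕ.∣ s ℕ.∸ s′
    n∣s∸s′ = subst (n ℕ.∣_) (trans (∣m⊖n∣≡∣n⊖m∣ s s′) (∣⊖∣-≰ s≰s′)) n∣s⊖s′

  ∣-⇒≡ : ∀ {n s s′} → s ℕ.< n → s′ ℕ.< n → + n ∣ + s - + s′ → s ≡ s′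
  ∣-⇒≡ {n} {s} {s′} s<n s′<n n∣s-s′ =
    ℕ.≤-antisym (∣⊖⇒≤ s<n n∣s⊖s′)
                (∣⊖⇒≤ s′<n (subst (n ℕ.∣_) (∣m⊖n∣≡∣n⊖m∣ s s′) n∣s⊖s′))
    where
    n∣s⊖s′ : n ℕ.∣ ∣ s ⊖ s′ ∣
    n∣s⊖s′ = subst (n ℕ.∣_) (cong ∣_∣ (m-n≡m⊖n s s′)) (∣⇒∣ᵤ n∣s-s′)

  %-≡⇒∣- : ∀ {n} x y .{{_ : NonZero n}} → x % n ≡ y % n → n ∣ x - y
  %-≡⇒∣- {n} x y x%n≡y%n = divides (x / n - y / n) (begin
    x - y
      ≡⟨ cong₂ _-_ (a≡a%n+[a/n]*n x n) (a≡a%n+[a/n]*n y n) ⟩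
    (+ (x % n) + x / n * n) - (+ (y % n) + y / n * n)
      ≡⟨ cong (λ r → (+ (x % n) + x / n * n) - (+ r + y / n * n)) x%n≡y%n ⟨
    (+ (x % n) + x / n * n) - (+ (x % n) + y / n * n)
      ≡⟨ cancel (+ (x % n)) (x / n) (y / n) n ⟩
    (x / n - y / n) * n
      ∎)
    where
    cancel : ∀ r q q′ n → (r + q * n) - (r + q′ * n) ≡ (q - q′) * n
    cancel = solve-∀

  ∣*⇒∣*% : ∀ {n} m x .{{_ : NonZero n}} → n ∣ + m * x → ∣ n ∣ ℕ.∣ m ℕ.* (x % n)
  ∣*⇒∣*% {n} m x n∣mx = subst (∣ n ∣ ℕ.∣_) (abs-* (+ m) (+ (x % n))) (∣⇒∣ᵤ n∣m[x%n])
    where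
    m[x%n]≡ : + m * + (x % n) ≡ + m * x - (+ m * (x / n)) * n
    m[x%n]≡ = begin
      + m * + (x % n)
        ≡⟨ rearrange (+ m) (+ (x % n)) (x / n) n ⟩
      + m * (+ (x % n) + x / n * n) - (+ m * (x / n)) * n
        ≡⟨ cong (λ z → + m * z - (+ m * (x / n)) * n) (a≡a%n+[a/n]*n x n) ⟨
      + m * x - (+ m * (x / n)) * n
        ∎
      where
      rearrange : ∀ m r q n → m * r ≡ m * (r + q * n) - (m * q) * n
      rearrange = solve-∀
    n∣m[x%n] : n ∣ + m * + (x % n)
    n∣m[x%n] = subst (n ∣_) (sym m[x%n]≡) (∣m∣n⇒∣m-n n∣mx (∣n⇒∣m*n (+ m * (x / n)) ∣-refl))

  i*j/j≡i : ∀ x y .{{_ : NonZero y}} → (x * y) / y ≡ x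
  i*j/j≡i x y = sym (*-cancelʳ-≡ x q y (begin
    x * y          ≡⟨ x*y≡r+q*y ⟩
    + r + q * y    ≡⟨ cong (λ r → + r + q * y) r≡0 ⟩
    + 0 + q * y    ≡⟨ +-identityˡ (q * y) ⟩
    q * y          ∎))
    where
    q = (x * y) / y
    r = (x * y) % y
    x*y≡r+q*y : x * y ≡ + r + q * y
    x*y≡r+q*y = a≡a%n+[a/n]*n (x * y) y
    r≡[x-q]*y : + r ≡ (x - q) * y
    r≡[x-q]*y = begin
      + r                  ≡⟨ cancel (+ r) q y ⟩
      (+ r + q * y) - q * y ≡⟨ cong (_- q * y) (sym x*y≡r+q*y) ⟩
      x * y - q * y        ≡⟨ distrib x q y ⟩
      (x - q) * y          ∎
      where
      cancel : ∀ r q y → r ≡ (r + q * y) - q * y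
      cancel = solve-∀
      distrib : ∀ x q y → x * y - q * y ≡ (x - q) * y
      distrib = solve-∀
    r≡0 : r ≡ 0
    r≡0 = ∣∧<⇒≡0 (∣⇒∣ᵤ (divides (x - q) r≡[x-q]*y)) (n%d<d (x * y) y)

  m+n≡o⇒o-n≡m : ∀ {d p q} → d ℕ.+ p ≡ q → + q - + p ≡ + d
  m+n≡o⇒o-n≡m {d} {p} refl = begin
    + (d ℕ.+ p) - + p  ≡⟨ cong (_- + p) (pos-+ d p) ⟩
    + d + + p - + p    ≡⟨ cancel (+ d) (+ p) ⟩
    + d                ∎
    where
    cancel : ∀ d p → d + p - p ≡ d
    cancel = solve-∀

  bézout-+- : ∀ {d m n} x y → d ℕ.+ y ℕ.* n ≡ x ℕ.* m → + x * + m + - + y * + n ≡ + d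
  bézout-+- {d} {m} {n} x y eq = begin
    + x * + m + - + y * + n        ≡⟨ cong₂ _+_ (sym (pos-* x m)) (sym (neg-distribˡ-* (+ y) (+ n))) ⟩
    + (x ℕ.* m) - + y * + n        ≡⟨ cong (λ z → + (x ℕ.* m) - z) (sym (pos-* y n)) ⟩
    + (x ℕ.* m) - + (y ℕ.* n)      ≡⟨ m+n≡o⇒o-n≡m eq ⟩
    + d                            ∎

  bézout-identity : ∀ {d m n} → Bézout.Identity d m n → ∃₂ λ u v → u * + m + v * + n ≡ + d
  bézout-identity (Bézout.+- x y eq) = + x , - + y , bézout-+- x y eq
  bézout-identity (Bézout.-+ x y eq) = - + x , + y , trans (+-comm (- + x * _) _) (bézout-+- y x eq)

  bézout : ∀ i j → ∃₂ λ u v → u * i + v * j ≡ + gcd ∣ i ∣ ∣ j ∣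
  bézout i j
    with bézout-identity (Bézout.identity (gcd-GCD ∣ i ∣ ∣ j ∣)) | m∣∣m∣ {i} | m∣∣m∣ {j}
  ... | u , v , eq | divides σ ∣i∣≡σi | divides τ ∣j∣≡τj = u * σ , v * τ , (begin
    u * σ * i + v * τ * j      ≡⟨ cong₂ _+_ (*-assoc u σ i) (*-assoc v τ j) ⟩
    u * (σ * i) + v * (τ * j)  ≡⟨ cong₂ (λ x y → u * x + v * y) (sym ∣i∣≡σi) (sym ∣j∣≡τj) ⟩
    u * (+ ∣ i ∣) + v * (+ ∣ j ∣)  ≡⟨ eq ⟩
    + gcd ∣ i ∣ ∣ j ∣              ∎)

  unimodular-∣ : ∀ {k u v p q x y} → u * p + v * q ≡ 1ℤ →
                 k ∣ p * x + q * y → k ∣ v * x - u * y → (k ∣ x) × (k ∣ y)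
  unimodular-∣ {k} {u} {v} {p} {q} {x} {y} det≡1 k∣L k∣W =
    subst (k ∣_) (recover x (recoverₓ u v p q x y))
      (∣m∣n⇒∣m+n (∣n⇒∣m*n u k∣L) (∣n⇒∣m*n q k∣W)) ,
    subst (k ∣_) (recover y (recoverᵧ u v p q x y))
      (∣m∣n⇒∣m-n (∣n⇒∣m*n v k∣L) (∣n⇒∣m*n p k∣W))
    where
    recover : ∀ z {w} → (u * p + v * q) * z ≡ w → w ≡ z
    recover z eq = trans (sym eq) (trans (cong (_* z) det≡1) (*-identityˡ z))
    recoverₓ : ∀ u v p q x y → (u * p + v * q) * x ≡ u * (p * x + q * y) + q * (v * x - u * y)
    recoverₓ = solve-∀
    recoverᵧ : ∀ u v p q x y → (u * p + v * q) * y ≡ v * (p * x + q * y) - p * (v * x - u * y)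
    recoverᵧ = solve-∀

module ListCounting where

  open import Data.Nat using (_≤_)
  open import Data.Fin using (Fin; zero; suc)
  open import Data.Fin.Properties using (injective⇒≤)
  open import Data.List using (List; []; _∷_; length; lookup; map; concatMap; cartesianProduct; _++_)
  open import Data.List.Membership.Propositional using (_∈_)
  open import Data.List.Membership.Propositional.Properties using (∈-lookup)
  open import Data.List.Relation.Unary.Any using (here)
  import Data.List.Relation.Unary.All as All
  open import Data.List.Relation.Unary.AllPairs using (_∷_)
  open import Data.List.Relation.Unary.Unique.Propositional using (Unique)
  open import Data.Product using (_,_; ∃)
  open import Data.Empty using (⊥-elim)
  open import Relation.Binary.PropositionalEquality

  length≢0⇒∃∈ : ∀ {A : Set} {xs : List A} → length xs ≢ 0 → ∃ (_∈ xs)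
  length≢0⇒∃∈ {xs = []}    length≢0 = ⊥-elim (length≢0 refl)
  length≢0⇒∃∈ {xs = x ∷ _} _        = x , here refl

  lookup-injective : ∀ {A : Set} {xs : List A} → Unique xs → ∀ i j → lookup xs i ≡ lookup xs j → i ≡ j
  lookup-injective (_   ∷ _) zero    zero    _  = refl
  lookup-injective (x∉ ∷ _) zero    (suc j) eq = ⊥-elim (All.lookup x∉ (∈-lookup j) eq)
  lookup-injective (x∉ ∷ _) (suc i) zero    eq = ⊥-elim (All.lookup x∉ (∈-lookup i) (sym eq))
  lookup-injective (_   ∷ u) (suc i) (suc j) eq = cong suc (lookup-injective u i j eq)

  Unique∧injective⇒length≤ : ∀ {A : Set} {K} {xs : List A} (f : A → Fin K) → Unique xs →
                             (∀ {x y} → x ∈ xs → y ∈ xs → f x ≡ f y → x ≡ y) → length xs ≤ K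
  Unique∧injective⇒length≤ f unique injective = injective⇒≤ λ {i} {j} eq →
    lookup-injective unique i j (injective (∈-lookup i) (∈-lookup j) eq)

  concatMap≡cartesianProduct : ∀ {A B : Set} (xs : List A) (ys : List B) →
                               concatMap (λ x → map (x ,_) ys) xs ≡ cartesianProduct xs ys
  concatMap≡cartesianProduct []       ys = refl
  concatMap≡cartesianProduct (x ∷ xs) ys = cong (map (x ,_) ys ++_) (concatMap≡cartesianProduct xs ys)

module QuadraticForm where

  open import Defs
  open IntegerArithmetic
  open ListCounting

  open import Data.Nat as ℕ using (ℕ; zero; suc)
  import Data.Nat.Properties as ℕ
  open import Data.Nat.Divisibility using (_∣0)
  open import Data.Nat.DivMod using (m<n*o⇒m/o<n; /-cancelʳ-≡)
  open import Data.Nat.GCD using (gcd; gcd[m,n]∣m; gcd[m,n]∣n; gcd[m,n]≡0⇒m≡0; gcd[m,n]≡0⇒n≡0)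
  open import Data.Fin using (Fin; fromℕ<; combine)
  open import Data.Fin.Properties using (fromℕ<-injective; combine-injective)
  open import Data.Integer hiding (suc)
  open import Data.Integer.Properties
  open import Data.Integer.Divisibility.Signed
  import Data.Integer.Divisibility as Unsigned
  open import Data.Integer.DivMod using (_/_; n%d<d)
  open import Data.Integer.Tactic.RingSolver using (solve-∀)
  open import Algebra.Properties.CommutativeSemigroup *-commutativeSemigroup using (x∙yz≈y∙xz)
  open import Data.List using (List; filter; upTo; cartesianProduct)
  open import Data.List.Membership.Propositional using (_∈_)
  open import Data.List.Membership.Propositional.Properties using (∈-filter⁻; ∈-cartesianProduct⁻; ∈-upTo⁻)
  open import Data.List.Relation.Unary.Unique.Propositional using (Unique)
  import Data.List.Relation.Unary.Unique.Propositional.Properties as Unique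
  open import Data.Product using (_×_; _,_; proj₁; proj₂; ∃₂)
  open import Data.Empty using (⊥-elim)
  open import Relation.Nullary using (Dec)
  open import Relation.Binary.PropositionalEquality
  open ≡-Reasoning

  scaleBE : ℤ → Coeffs → Coeffs
  scaleBE G c = coeffs (a c) (b c * G) (d c) (e c * G) (f c)

  -- solve-∀ does not unfold definitions, so identities are proved in unfolded form.
  ΔQ-scaleBE : ∀ G c → ΔQ (scaleBE G c) ≡ G * ΔQ c * G
  ΔQ-scaleBE G c = unfolded (a c) (b c) (d c) (e c) (f c) G
    where
    unfolded : ∀ a b d e f G → a * (e * G) * (e * G) - d * (e * G) * (b * G) + f * (b * G) * (b * G)
                              ≡ G * (a * e * e - d * e * b + f * b * b) * G
    unfolded = solve-∀

  Lf-scaleBE : ∀ G c s t → Lf (scaleBE G c) s t ≡ G * Lf c s t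
  Lf-scaleBE G c = unfolded (b c) (e c) G
    where
    unfolded : ∀ b e G s t → b * G * s + e * G * t ≡ G * (b * s + e * t)
    unfolded = solve-∀

  s²ΔQ-identity : ∀ c y s t → s * (s * (y * ΔQ c)) ≡
    y * e c * e c * gf c s t - y * Lf c s t * (d c * e c * s + f c * e c * t - f c * b c * s)
  s²ΔQ-identity c = unfolded (a c) (b c) (d c) (e c) (f c)
    where
    unfolded : ∀ a b d e f y s t → s * (s * (y * (a * e * e - d * e * b + f * b * b))) ≡
      y * e * e * (a * s * s + d * s * t + f * t * t) - y * (b * s + e * t) * (d * e * s + f * e * t - f * b * s)
    unfolded = solve-∀

  t²ΔQ-identity : ∀ c y s t → t * (t * (y * ΔQ c)) ≡
    y * b c * b c * gf c s t - y * Lf c s t * (a c * b c * s - a c * e c * t + d c * b c * t)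
  t²ΔQ-identity c = unfolded (a c) (b c) (d c) (e c) (f c)
    where
    unfolded : ∀ a b d e f y s t → t * (t * (y * (a * e * e - d * e * b + f * b * b))) ≡
      y * b * b * (a * s * s + d * s * t + f * t * t) - y * (b * s + e * t) * (a * b * s - a * e * t + d * b * t)
    unfolded = solve-∀

  stΔQ-identity : ∀ c y s t → s * (t * (y * ΔQ c)) ≡
    y * Lf c s t * (a c * e c * s + f c * b c * t) - y * b c * e c * gf c s t
  stΔQ-identity c = unfolded (a c) (b c) (d c) (e c) (f c)
    where
    unfolded : ∀ a b d e f y s t → s * (t * (y * (a * e * e - d * e * b + f * b * b))) ≡
      y * (b * s + e * t) * (a * e * s + f * b * t) - y * b * e * (a * s * s + d * s * t + f * t * t)
    unfolded = solve-∀

  ∣L∧∣g⇒∣ΔQ : ∀ c y {n s t} → gcd (gcd s t) n ≡ 1 →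
              + n ∣ y * Lf c (+ s) (+ t) → + n ∣ gf c (+ s) (+ t) → + n ∣ y * ΔQ c
  ∣L∧∣g⇒∣ΔQ c y {n} {s} {t} coprime n∣yL n∣g =
    cancel (cancel n∣s²X n∣tsX) (cancel n∣stX n∣t²X)
    where
    S = + s
    T = + t
    X = y * ΔQ c
    cancel : ∀ {z} → + n ∣ S * z → + n ∣ T * z → + n ∣ z
    cancel = ∣-cancel-coprime {s = s} {t} coprime
    n∣s²X : + n ∣ S * (S * X)
    n∣s²X = subst (+ n ∣_) (sym (s²ΔQ-identity c y S T))
      (∣m∣n⇒∣m-n (∣n⇒∣m*n (y * e c * e c) n∣g)
                 (∣m⇒∣m*n (d c * e c * S + f c * e c * T - f c * b c * S) n∣yL))
    n∣t²X : + n ∣ T * (T * X)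
    n∣t²X = subst (+ n ∣_) (sym (t²ΔQ-identity c y S T))
      (∣m∣n⇒∣m-n (∣n⇒∣m*n (y * b c * b c) n∣g)
                 (∣m⇒∣m*n (a c * b c * S - a c * e c * T + d c * b c * T) n∣yL))
    n∣stX : + n ∣ S * (T * X)
    n∣stX = subst (+ n ∣_) (sym (stΔQ-identity c y S T))
      (∣m∣n⇒∣m-n (∣m⇒∣m*n (a c * e c * S + f c * b c * T) n∣yL)
                 (∣n⇒∣m*n (y * b c * e c) n∣g))
    n∣tsX : + n ∣ T * (S * X)
    n∣tsX = subst (+ n ∣_) (x∙yz≈y∙xz S T X) n∣stX

  good⇒∣L : ∀ {c n s t} → Good c n s t → + n ∣ Lf c (+ s) (+ t)
  good⇒∣L {s = s} {t} ((n∣sL , _ , n∣tL) , coprime) =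
    ∣-cancel-coprime {s = s} {t} coprime (∣ᵤ⇒∣ n∣sL) (∣ᵤ⇒∣ n∣tL)

  good⇒∣g : ∀ {c n s t} → Good c n s t → + n ∣ gf c (+ s) (+ t)
  good⇒∣g {c} {s = s} {t} ((_ , n∣-g , _) , _) =
    subst (_ ∣_) (neg-involutive (gf c (+ s) (+ t))) (∣m⇒∣-m (∣ᵤ⇒∣ n∣-g))

  scaleBE-good⇒∣ΔQ : ∀ G c {n s t} → Good (scaleBE G c) n s t → + n ∣ G * ΔQ c
  scaleBE-good⇒∣ΔQ G c {n} {s} {t} good = ∣L∧∣g⇒∣ΔQ c G {n} {s} {t} (proj₂ good)
    (subst (_ ∣_) (Lf-scaleBE G c (+ s) (+ t)) (good⇒∣L {scaleBE G c} good))
    (good⇒∣g {scaleBE G c} good)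

  pairs≡cartesianProduct : ∀ n → pairs n ≡ cartesianProduct (upTo n) (upTo n)
  pairs≡cartesianProduct n = concatMap≡cartesianProduct (upTo n) (upTo n)

  goodPair? : ∀ c n (p : ℕ × ℕ) → Dec (Good c n (proj₁ p) (proj₂ p))
  goodPair? c n p = good? c n (proj₁ p) (proj₂ p)

  goodPairs : Coeffs → ℕ → List (ℕ × ℕ)
  goodPairs c n = filter (goodPair? c n) (pairs n)

  ∈-goodPairs⁻ : ∀ {c n s t} → (s , t) ∈ goodPairs c n → s ℕ.< n × t ℕ.< n × Good c n s t
  ∈-goodPairs⁻ {c} {n} p∈ with ∈-filter⁻ (goodPair? c n) p∈
  ... | p∈pairs , good
    with ∈-cartesianProduct⁻ (upTo n) (upTo n) (subst (_ ∈_) (pairs≡cartesianProduct n) p∈pairs)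
  ... | s∈ , t∈ = ∈-upTo⁻ s∈ , ∈-upTo⁻ t∈ , good

  goodPairs-unique : ∀ c n → Unique (goodPairs c n)
  goodPairs-unique c n = Unique.filter⁺ (goodPair? c n) (subst Unique (sym (pairs≡cartesianProduct n))
    (Unique.cartesianProduct⁺ (Unique.upTo⁺ n) (Unique.upTo⁺ n)))

  ρ*≢0⇒good : ∀ c n → ρ* c n ≢ 0 → ∃₂ λ s t → Good c n s t
  ρ*≢0⇒good c n ρ*≢0 with length≢0⇒∃∈ {xs = goodPairs c n} ρ*≢0
  ... | (s , t) , p∈ = s , t , proj₂ (proj₂ (∈-goodPairs⁻ {c} p∈))

  gcdBE∣b : ∀ c → + gcdBE c ∣ b c
  gcdBE∣b c = ∣ᵤ⇒∣ (gcd[m,n]∣m ∣ b c ∣ ∣ e c ∣)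

  gcdBE∣e : ∀ c → + gcdBE c ∣ e c
  gcdBE∣e c = ∣ᵤ⇒∣ (gcd[m,n]∣n ∣ b c ∣ ∣ e c ∣)

  record Reduction (c : Coeffs) (G : ℤ) : Set where
    field
      reduced : Coeffs
      scaled  : c ≡ scaleBE G reduced
      u v     : ℤ
      det≡1   : u * b reduced + v * e reduced ≡ 1ℤ

  reduction : ∀ c {k} → gcdBE c ≡ suc k → Reduction c (+ suc k)
  reduction c {k} gcdBE≡
    with subst (λ m → + m ∣ b c) gcdBE≡ (gcdBE∣b c)
       | subst (λ m → + m ∣ e c) gcdBE≡ (gcdBE∣e c)
       | bézout (b c) (e c)
  ... | divides β b≡βG | divides ε e≡εG | u , v , bézout≡ = record
    { reduced = coeffs (a c) β (d c) ε (f c)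
    ; scaled  = cong₂ (λ x y → coeffs (a c) x (d c) y (f c)) b≡βG e≡εG
    ; u       = u
    ; v       = v
    ; det≡1   = *-cancelʳ-≡ _ _ G (begin
        (u * β + v * ε) * G        ≡⟨ distrib u v β ε G ⟩
        u * (β * G) + v * (ε * G)  ≡⟨ cong₂ (λ x y → u * x + v * y) b≡βG e≡εG ⟨
        u * b c + v * e c          ≡⟨ bézout≡ ⟩
        + gcdBE c                  ≡⟨ cong +_ gcdBE≡ ⟩
        G                          ≡⟨ *-identityˡ G ⟨
        1ℤ * G                     ∎)
    }
    where
    G = + suc k
    distrib : ∀ u v β ε G → (u * β + v * ε) * G ≡ u * (β * G) + v * (ε * G)
    distrib = solve-∀

  ΔQ/G≡G*ΔQ-reduced : ∀ {c k} (r : Reduction c (+ suc k)) →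
                      ΔQ c / + suc k ≡ + suc k * ΔQ (Reduction.reduced r)
  ΔQ/G≡G*ΔQ-reduced {c} {k} r = begin
    ΔQ c / G                   ≡⟨ cong (λ c → ΔQ c / G) scaled ⟩
    ΔQ (scaleBE G reduced) / G ≡⟨ cong (_/ G) (ΔQ-scaleBE G reduced) ⟩
    G * ΔQ reduced * G / G     ≡⟨ i*j/j≡i (G * ΔQ reduced) G ⟩
    G * ΔQ reduced             ∎
    where
    open Reduction r
    G = + suc k

  gcdBE≡0⇒ΔQ≡0 : ∀ c → gcdBE c ≡ 0 → ΔQ c ≡ 0ℤ
  gcdBE≡0⇒ΔQ≡0 c gcdBE≡0 =
    trans (cong₂ (λ x y → ΔQ (coeffs (a c) x (d c) y (f c))) b≡0 e≡0) (ΔQ[b=e=0] (a c) (d c) (f c))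
    where
    b≡0 : b c ≡ 0ℤ
    b≡0 = ∣i∣≡0⇒i≡0 (gcd[m,n]≡0⇒m≡0 gcdBE≡0)
    e≡0 : e c ≡ 0ℤ
    e≡0 = ∣i∣≡0⇒i≡0 (gcd[m,n]≡0⇒n≡0 ∣ b c ∣ gcdBE≡0)
    ΔQ[b=e=0] : ∀ a d f → a * 0ℤ * 0ℤ - d * 0ℤ * 0ℤ + f * 0ℤ * 0ℤ ≡ 0ℤ
    ΔQ[b=e=0] = solve-∀

  ρ*≢0⇒∣ΔQ/gcd : ∀ c n → ρ* c n ≢ 0 → + n Unsigned.∣ ΔQ/gcd c
  ρ*≢0⇒∣ΔQ/gcd c n ρ*≢0 with gcdBE c in gcdBE≡ | ρ*≢0⇒good c n ρ*≢0
  ... | zero  | _            = n ∣0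
  ... | suc k | s , t , good = ∣⇒∣ᵤ (subst (+ n ∣_) (sym (ΔQ/G≡G*ΔQ-reduced r))
    (scaleBE-good⇒∣ΔQ (+ suc k) reduced {n} {s} {t} (subst (λ c → Good c n s t) scaled good)))
    where
    r = reduction c gcdBE≡
    open Reduction r

  module Encoding (c : Coeffs) {u v : ℤ} (det≡1 : u * b c + v * e c ≡ 1ℤ)
                  (G n : ℕ) .{{_ : ℕ.NonZero G}} .{{_ : ℕ.NonZero n}} where

    W : ℕ → ℕ → ℤ
    W s t = v * + s - u * + t

    residue : ℤ → Fin n
    residue x = fromℕ< (n%d<d x (+ n))

    scaledResidue : ℤ → Fin G
    scaledResidue x = fromℕ< (m<n*o⇒m/o<n (ℕ.*-monoʳ-< G (n%d<d x (+ n))))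

    encode : ℕ × ℕ → Fin (n ℕ.* G)
    encode (s , t) = combine (residue (W s t)) (scaledResidue (Lf c (+ s) (+ t)))

    residue-injective : ∀ x y → residue x ≡ residue y → + n ∣ x - y
    residue-injective x y eq = %-≡⇒∣- x y (fromℕ<-injective _ _ _ _ eq)

    scaledResidue-injective : ∀ x y → + n ∣ + G * x → + n ∣ + G * y →
                              scaledResidue x ≡ scaledResidue y → + n ∣ x - y
    scaledResidue-injective x y n∣Gx n∣Gy eq = %-≡⇒∣- x y (ℕ.*-cancelˡ-≡ _ _ G
      (/-cancelʳ-≡ (∣*⇒∣*% G x n∣Gx) (∣*⇒∣*% G y n∣Gy) (fromℕ<-injective _ _ _ _ eq)))

    Admissible : ℕ × ℕ → Set
    Admissible (s , t) = s ℕ.< n × t ℕ.< n × + n ∣ + G * Lf c (+ s) (+ t)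

    encode-injective : ∀ {p q} → Admissible p → Admissible q → encode p ≡ encode q → p ≡ q
    encode-injective {s , t} {s′ , t′} (s<n , t<n , n∣GL) (s′<n , t′<n , n∣GL′) eq =
      cong₂ _,_ (∣-⇒≡ s<n s′<n (proj₁ n∣Δs,Δt)) (∣-⇒≡ t<n t′<n (proj₂ n∣Δs,Δt))
      where
      Δs = + s - + s′
      Δt = + t - + t′
      residues≡ = combine-injective (residue (W s t)) (scaledResidue (Lf c (+ s) (+ t)))
                                    (residue (W s′ t′)) (scaledResidue (Lf c (+ s′) (+ t′))) eq
      ΔL : ∀ b e s t s′ t′ → (b * s + e * t) - (b * s′ + e * t′) ≡ b * (s - s′) + e * (t - t′)
      ΔL = solve-∀
      ΔW : ∀ u v s t s′ t′ → (v * s - u * t) - (v * s′ - u * t′) ≡ v * (s - s′) - u * (t - t′)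
      ΔW = solve-∀
      n∣ΔL : + n ∣ b c * Δs + e c * Δt
      n∣ΔL = subst (+ n ∣_) (ΔL (b c) (e c) (+ s) (+ t) (+ s′) (+ t′))
        (scaledResidue-injective (Lf c (+ s) (+ t)) (Lf c (+ s′) (+ t′)) n∣GL n∣GL′ (proj₂ residues≡))
      n∣ΔW : + n ∣ v * Δs - u * Δt
      n∣ΔW = subst (+ n ∣_) (ΔW u v (+ s) (+ t) (+ s′) (+ t′))
        (residue-injective (W s t) (W s′ t′) (proj₁ residues≡))
      n∣Δs,Δt = unimodular-∣ {u = u} {v} {b c} {e c} {Δs} {Δt} det≡1 n∣ΔL n∣ΔW

  ρ*-scaleBE≤ : ∀ c {u v} → u * b c + v * e c ≡ 1ℤ →
                ∀ G n .{{_ : ℕ.NonZero G}} .{{_ : ℕ.NonZero n}} → ρ* (scaleBE (+ G) c) n ℕ.≤ n ℕ.* G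
  ρ*-scaleBE≤ c {u} {v} det≡1 G n = Unique∧injective⇒length≤ encode (goodPairs-unique (scaleBE (+ G) c) n)
    λ {p} {q} p∈ q∈ → encode-injective {p} {q} (admissible p∈) (admissible q∈)
    where
    open Encoding c {u} {v} det≡1 G n
    admissible : ∀ {p} → p ∈ goodPairs (scaleBE (+ G) c) n → Admissible p
    admissible {s , t} p∈ with ∈-goodPairs⁻ {scaleBE (+ G) c} p∈
    ... | s<n , t<n , good =
      s<n , t<n , subst (+ n ∣_) (Lf-scaleBE (+ G) c (+ s) (+ t)) (good⇒∣L {scaleBE (+ G) c} good)

  ρ*≤n*gcdBE : ∀ c → ΔQ c ≢ 0ℤ → ∀ n → 0 ℕ.< n → ρ* c n ℕ.≤ n ℕ.* gcdBE c
  ρ*≤n*gcdBE c ΔQ≢0 n@(suc _) _ with gcdBE c in gcdBE≡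
  ... | zero  = ⊥-elim (ΔQ≢0 (gcdBE≡0⇒ΔQ≡0 c gcdBE≡))
  ... | suc k = subst (λ c → ρ* c n ℕ.≤ n ℕ.* suc k) (sym scaled)
                  (ρ*-scaleBE≤ reduced {u} {v} det≡1 (suc k) n)
    where open Reduction (reduction c gcdBE≡)

open import Defs
open import Data.Nat using (ℕ; _*_; _≤_; _<_)
open import Data.Integer using (ℤ; +_; 0ℤ)
open import Data.Integer.Divisibility using (_∣_)
open import Data.Product using (_×_; _,_)
open import Relation.Binary.PropositionalEquality using (_≡_; _≢_)
open QuadraticForm using (ρ*≢0⇒∣ΔQ/gcd; ρ*≤n*gcdBE)

lemma1 : (a b d e f : ℤ) → ΔQ (coeffs a b d e f) ≢ 0ℤ →
    ((n : ℕ) → 0 < n → ρ* (coeffs a b d e f) n ≢ 0 → (+ n) ∣ ΔQ/gcd (coeffs a b d e f))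
    × ((n : ℕ) → 0 < n → ρ* (coeffs a b d e f) n ≤ n * gcdBE (coeffs a b d e f))
lemma1 a b d e f ΔQ≢0 =
  (λ n _ → ρ*≢0⇒∣ΔQ/gcd (coeffs a b d e f) n) , ρ*≤n*gcdBE (coeffs a b d e f) ΔQ≢0
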